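{- Fix a positive integer $k$. Then for each positive integer $d\geq\max\{k+2,\;3+2\sqrt{k+2}\}$ such that $d+k$ is composite, we have $H_d(n)\equiv1\pmod{d+k}$ for all $n\in\mathbb{N}$.
   Context: $\mathbb{N}$ denotes the non-negative integers. For an integer $d\geq2$ and $n\in\mathbb{N}$, $H_d(n)$ is the number of permutations in $S_n$ that are products of pairwise disjoint $d$-cycles (identity included); equivalently $H_d(n)=1$ for $0\le n\le d-1$ and $H_d(n)=H_d(n-1)+(n-1)(n-2)\cdots(n-d+1)H_d(n-d)$ for $n\ge d$. -}

module Defs where

open import Data.Nat using (ℕ; zero; suc; _+_; _*_; _∸_; _<ᵇ_)
open import Data.Bool using (if_then_else_)

fall : ℕ → ℕ → ℕ
fall m zero    = 1
fall m (suc j) = m * fall (m ∸ 1) j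

-- Hfuel d fuel n computes H_d(n) provided n ≤ fuel, via
--   H_d(n) = 1 for n < d,
--   H_d(n) = H_d(n-1) + (n-1)(n-2)...(n-d+1) H_d(n-d) for n ≥ d.
Hfuel : ℕ → ℕ → ℕ → ℕ
Hfuel d zero       n = 1
Hfuel d (suc fuel) n =
  if n <ᵇ d then 1
  else Hfuel d fuel (n ∸ 1) + fall (n ∸ 1) (d ∸ 1) * Hfuel d fuel (n ∸ d)

-- H_d(n): number of permutations of S_n that are products of disjoint d-cycles
-- (meaningful for d ≥ 2)
H : ℕ → ℕ → ℕ
H d n = Hfuel d n n

{-# OPTIONS --safe #-}
-- For n ≥ d the recursion adds fall (n - 1) (d - 1) · H_d(n - d), a product of d - 1
-- consecutive integers and hence a multiple of (d - 1)!. A composite m = d + k = a b with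
-- m ≤ 2(d - 1) and 4m ≤ (d - 1)² divides (d - 1)!: both factors are at most d - 1, and
-- when a = b also 2a ≤ d - 1, so a and 2a are distinct factors of (d - 1)!. Thus every
-- step of the recursion preserves H ≡ 1 (mod d + k), starting from H = 1 for n < d.
module Submission where

open import Defs
open import Data.Nat using (ℕ; _+_; _*_; _∸_; _≤_; _<_)
open import Data.Nat.Primality using (Composite)
open import Data.Nat.Divisibility using (_∣_)

open import Data.Nat.Base using (zero; suc; _!; s≤s; _<ᵇ_; nonTrivial⇒n>1; >-nonZero)
open import Data.Nat.Properties
open import Data.Nat.Divisibility
  using (divides; ∣-trans; m∣m*n; *-monoʳ-∣; m≤n⇒m!∣n!; quotient>1)
open import Data.Nat.Divisibility.Core using (hasNonTrivialDivisor)
open import Data.Nat.Combinatorics.Base using (_P′_)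
open import Data.Nat.Combinatorics.Specification using (k!∣nP′k; nP′k≡n[n∸1P′k∸1])
open import Data.Nat.Tactic.RingSolver using (solve)
open import Data.Bool using (true; false; T)
open import Data.List using (_∷_; [])
open import Data.Product using (∃-syntax; _,_)
open import Relation.Binary.Definitions using (tri<; tri≈; tri>)
open import Relation.Binary.PropositionalEquality

fall≡P′ : ∀ m j → fall m j ≡ m P′ j
fall≡P′ m       zero    = refl
fall≡P′ zero    (suc j) = cong (_* (0 P′ j)) (sym (0∸n≡0 j))
fall≡P′ (suc m) (suc j) =
  trans (cong (suc m *_) (fall≡P′ m j)) (sym (nP′k≡n[n∸1P′k∸1] (suc m) (suc j)))

j!∣fall : ∀ {m j} → j ≤ m → j ! ∣ fall m j
j!∣fall {m} {j} j≤m = subst (j ! ∣_) (sym (fall≡P′ m j)) (k!∣nP′k j≤m)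

m*m≤n*n⇒m≤n : ∀ {m n} → m * m ≤ n * n → m ≤ n
m*m≤n*n⇒m≤n m*m≤n*n = ≮⇒≥ λ n<m → <⇒≱ (*-mono-< n<m n<m) m*m≤n*n

*-∣-!-distinct : ∀ {a b j} → 1 ≤ a → a < b → b ≤ j → a * b ∣ j !
*-∣-!-distinct {suc a} {suc b} {j} _ (s≤s a≤b) b≤j = begin
  suc a * suc b   ≡⟨ *-comm (suc a) (suc b) ⟩
  suc b * suc a   ∣⟨ *-monoʳ-∣ (suc b) (∣-trans (m∣m*n (a !)) (m≤n⇒m!∣n! a≤b)) ⟩
  suc b * b !     ∣⟨ m≤n⇒m!∣n! b≤j ⟩
  j !             ∎
  where open Data.Nat.Divisibility.∣-Reasoning

-- In the square case a · a ∣ a · 2a, and a, 2a are distinct factors of j!.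
*-∣-! : ∀ {a b j} → 2 ≤ a → 2 ≤ b → a * b ≤ 2 * j → 4 * (a * b) ≤ j * j → a * b ∣ j !
*-∣-! {a} {b} {j} 2≤a 2≤b ab≤2j 4ab≤jj with <-cmp a b
... | tri< a<b _ _ = *-∣-!-distinct (<⇒≤ 2≤a) a<b b≤j
  where
  b≤j : b ≤ j
  b≤j = *-cancelˡ-≤ 2 (≤-trans (*-monoˡ-≤ b 2≤a) ab≤2j)
... | tri> _ _ b<a = subst (_∣ j !) (*-comm b a) (*-∣-!-distinct (<⇒≤ 2≤b) b<a a≤j)
  where
  a≤j : a ≤ j
  a≤j = *-cancelˡ-≤ 2 (≤-trans (*-monoˡ-≤ a 2≤b) (subst (_≤ 2 * j) (*-comm a b) ab≤2j))
... | tri≈ _ refl _ = ∣-trans (*-monoʳ-∣ a (m∣m*n 2)) (*-∣-!-distinct 1≤a a<a*2 a*2≤j)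
  where
  1≤a : 1 ≤ a
  1≤a = <⇒≤ 2≤a
  a<a*2 : a < a * 2
  a<a*2 = m<m*n a 2 ≤-refl
    where instance _ = >-nonZero 1≤a
  a*2≤j : a * 2 ≤ j
  a*2≤j = m*m≤n*n⇒m≤n (subst (_≤ j * j) 4[a*a]≡[a*2]² 4ab≤jj)
    where
    4[a*a]≡[a*2]² : 4 * (a * a) ≡ a * 2 * (a * 2)
    4[a*a]≡[a*2]² = solve (a ∷ [])

composite-∣-! : ∀ {m j} → Composite m → m ≤ 2 * j → 4 * m ≤ j * j → m ∣ j !
composite-∣-! {j = j} (hasNonTrivialDivisor {a} a<m m≡ba@(divides b refl)) =
  *-∣-! {j = j} (quotient>1 m≡ba a<m) (nonTrivial⇒n>1 a)

d+k≤2[d∸1] : ∀ {k d} → 3 ≤ d → k + 2 ≤ d → d + k ≤ 2 * (d ∸ 1)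
d+k≤2[d∸1] {k} {suc (suc (suc e))} (s≤s (s≤s (s≤s _))) k+2≤d = begin
  3 + e + k        ≤⟨ +-monoʳ-≤ (3 + e) (m+n≤o⇒m≤o∸n k k+2≤d) ⟩
  3 + e + (1 + e)  ≡⟨ solve (e ∷ []) ⟩
  2 * (2 + e)      ∎
  where open ≤-Reasoning

4[d+k]≤[d∸1]² : ∀ {k d} → 3 ≤ d → 4 * (k + 2) ≤ (d ∸ 3) * (d ∸ 3) →
                4 * (d + k) ≤ (d ∸ 1) * (d ∸ 1)
4[d+k]≤[d∸1]² {k} {suc (suc (suc e))} (s≤s (s≤s (s≤s _))) 4[k+2]≤e² = begin
  4 * (3 + e + k)              ≡⟨ solve (e ∷ k ∷ []) ⟩
  4 + 4 * e + 4 * (k + 2)      ≤⟨ +-monoʳ-≤ (4 + 4 * e) 4[k+2]≤e² ⟩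
  4 + 4 * e + e * e            ≡⟨ solve (e ∷ []) ⟩
  (2 + e) * (2 + e)            ∎
  where open ≤-Reasoning

Hfuel≡1+multiple : ∀ {d M} → (∀ {n} → d ≤ n → M ∣ fall (n ∸ 1) (d ∸ 1)) →
                   ∀ fuel n → ∃[ q ] Hfuel d fuel n ≡ 1 + q * M
Hfuel≡1+multiple step zero n = 0 , refl
Hfuel≡1+multiple {d} {M} step (suc fuel) n with n <ᵇ d in n<ᵇd
... | true  = 0 , refl
... | false
  with q₁ , H₁ ← Hfuel≡1+multiple step fuel (n ∸ 1)
     | q₂ , H₂ ← Hfuel≡1+multiple step fuel (n ∸ d)
     | divides c fall≡cM ← step (≮⇒≥ (λ n<d → subst T n<ᵇd (<⇒<ᵇ n<d))) =
  q₁ + c * (1 + q₂ * M) , (begin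
    Hfuel d fuel (n ∸ 1) + fall (n ∸ 1) (d ∸ 1) * Hfuel d fuel (n ∸ d)
      ≡⟨ cong₂ _+_ H₁ (cong₂ _*_ fall≡cM H₂) ⟩
    1 + q₁ * M + c * M * (1 + q₂ * M)
      ≡⟨ solve (q₁ ∷ q₂ ∷ c ∷ M ∷ []) ⟩
    1 + (q₁ + c * (1 + q₂ * M)) * M ∎)
  where open ≡-Reasoning

mainTheorem19 : (k : ℕ) → 0 < k → (d : ℕ) → k + 2 ≤ d →
    4 * (k + 2) ≤ (d ∸ 3) * (d ∸ 3) → Composite (d + k) →
    (n : ℕ) → (d + k) ∣ (H d n ∸ 1)
mainTheorem19 k 0<k d k+2≤d 4[k+2]≤[d∸3]² d+k-composite n =
  let q , H≡1+qM = Hfuel≡1+multiple d+k∣coefficient n n in divides q (cong (_∸ 1) H≡1+qM)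
  where
  3≤d : 3 ≤ d
  3≤d = ≤-trans (+-monoˡ-≤ 2 0<k) k+2≤d

  d+k∣[d∸1]! : d + k ∣ (d ∸ 1) !
  d+k∣[d∸1]! = composite-∣-! {j = d ∸ 1} d+k-composite
    (d+k≤2[d∸1] 3≤d k+2≤d) (4[d+k]≤[d∸1]² 3≤d 4[k+2]≤[d∸3]²)

  d+k∣coefficient : ∀ {m} → d ≤ m → d + k ∣ fall (m ∸ 1) (d ∸ 1)
  d+k∣coefficient d≤m = ∣-trans d+k∣[d∸1]! (j!∣fall (∸-monoˡ-≤ 1 d≤m))
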